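{- If a finite graph $G$ has minimum degree at least two, then $B(G)\le B'(G)$.
   Context: For a graph $G$, the bandwidth $B(G)$ is the minimum, over all assignments $g$ of distinct integers to the vertices of $G$, of $\max_{uv\in E(G)}|g(u)-g(v)|$. An edge-numbering of $G$ is an assignment $f$ of distinct integers to the edges of $G$; $B'(f)$ is the maximum of $|f(e)-f(e')|$ over pairs of distinct incident edges $e,e'$ (sharing an endpoint). The edge-bandwidth $B'(G)$ is the minimum of $B'(f)$ over all edge-numberings $f$ of $G$. -}

module Defs where

open import Data.Nat using (ℕ; _≤_; _<_)
open import Data.Bool using (Bool; true; false; T)
open import Data.Fin using (Fin; toℕ)
open import Data.List using (List; length; filter; allFin)
open import Data.Integer using (ℤ; ∣_∣; _-_)
open import Data.Product using (Σ; _×_; _,_; proj₁; proj₂; ∃)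
open import Data.Sum using (_⊎_)
open import Relation.Nullary using (¬_)
open import Relation.Nullary.Decidable using (T?)
open import Relation.Binary.PropositionalEquality using (_≡_)

record Graph (n : ℕ) : Set where
  field
    adj   : Fin n → Fin n → Bool
    sym   : ∀ u v → adj u v ≡ adj v u
    irrefl : ∀ u → adj u u ≡ false

open Graph public

module _ {n : ℕ} (G : Graph n) where

  degree : Fin n → ℕ
  degree u = length (filter (λ v → T? (adj G u v)) (allFin n))

  minDegree≥ : ℕ → Set
  minDegree≥ d = ∀ u → d ≤ degree u

  -- an edge {u,v}, represented canonically by its endpoints with u < v
  Edge : Set
  Edge = Σ (Fin n × Fin n) λ p → (toℕ (proj₁ p) < toℕ (proj₂ p)) × T (adj G (proj₁ p) (proj₂ p))

  ends : Edge → Fin n × Fin n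
  ends e = proj₁ e

  Distinct : Edge → Edge → Set
  Distinct e e' = ¬ (ends e ≡ ends e')

  ShareEnd : Edge → Edge → Set
  ShareEnd ((a , b) , _) ((c , d) , _) =
    (a ≡ c) ⊎ (a ≡ d) ⊎ (b ≡ c) ⊎ (b ≡ d)

  VertexNumbering : Set
  VertexNumbering = Σ (Fin n → ℤ) λ g → ∀ u v → g u ≡ g v → u ≡ v

  EdgeNumbering : Set
  EdgeNumbering = Σ (Edge → ℤ) λ f → ∀ e e' → f e ≡ f e' → ends e ≡ ends e'

  VBW≤ : VertexNumbering → ℕ → Set
  VBW≤ (g , _) k = ∀ (e : Edge) → ∣ g (proj₁ (ends e)) - g (proj₂ (ends e)) ∣ ≤ k

  EBW≤ : EdgeNumbering → ℕ → Set
  EBW≤ (f , _) k = ∀ (e e' : Edge) → Distinct e e' → ShareEnd e e' → ∣ f e - f e' ∣ ≤ k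

  -- b is the bandwidth B(G): the minimum over vertex numberings g of B(g)
  IsBandwidth : ℕ → Set
  IsBandwidth b = (∃ λ g → VBW≤ g b) × (∀ g k → VBW≤ g k → b ≤ k)

  -- b is the edge-bandwidth B'(G): the minimum over edge numberings f of B'(f)
  IsEdgeBandwidth : ℕ → Set
  IsEdgeBandwidth b = (∃ λ f → EBW≤ f b) × (∀ f k → EBW≤ f k → b ≤ k)

-- Let f be an edge numbering with B'(f) ≤ k. Label every vertex v by f(φ v) for an edge
-- φ v at v, where φ is injective and, for every edge e, both endpoints of e receive labels
-- ≤ f e or both receive labels ≥ f e. Each endpoint label is the label of an edge meeting
-- e, hence within k of f e; lying on the same side of f e, the two labels of adjacent
-- vertices are then within k of each other, so B(G) ≤ k.
--
-- φ is built by running through the edges in increasing order of f while maintaining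
-- Hall's condition for the set L of still unlabelled vertices: every S ⊆ L meets at least
-- ∣S∣ of the remaining edges. An edge with exactly one endpoint in L must give its label
-- to that endpoint; an edge with both endpoints in L gives it to one of them, and by
-- submodularity of S ↦ #(edges meeting S) one of the two choices preserves Hall's
-- condition. Initially the condition holds by double counting, as all degrees are ≥ 2.

module Submission where

open import Defs hiding (sym)

open import Algebra.Properties.CommutativeSemigroup using (interchange)
open import Data.Bool using (Bool; true; false; T; _∨_; _∧_)
open import Data.Bool.Properties using (∨-zeroʳ; T-irrelevant)
open import Data.Empty using (⊥)
open import Data.Fin using (Fin; zero; suc; toℕ)
open import Data.Fin.Properties using (_≟_; toℕ-injective)
open import Data.Fin.Subset using (Subset; inside; outside; ⊤; _∈_; _∉_; _⊆_; _∪_; _∩_; _-_; ⁅_⁆; ∣_∣)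
open import Data.Fin.Subset.Properties
  using (_∈?_; _⊆?_; anySubset?; ∈⊤; ⊆-refl; ⊆-trans; p─q⊆p; p∩q⊆p; p∩q⊆q; x∈p∪q⁻;
         x∈p∧x≢y⇒x∈p-y; x∈⁅y⁆⇒x≡y; ∣⁅x⁆∣≡1)
import Data.Integer as ℤ
open import Data.Integer using (ℤ; 0ℤ)
import Data.Integer.Properties as ℤ
open import Data.List using (List; []; _∷_; length; filter; concatMap; allFin; deduplicate)
open import Data.List.Membership.Propositional using (lose) renaming (_∈_ to _∈ₗ_)
open import Data.List.Membership.Propositional.Properties using (∈-concatMap⁺; ∈-allFin; ∈-filter⁻; ∈-deduplicate⁺)
open import Data.List.Relation.Binary.Permutation.Propositional using (↭-sym; ↭⇒↭ₛ)
open import Data.List.Relation.Binary.Permutation.Propositional.Properties using (∈-resp-↭)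
import Data.List.Relation.Unary.All as All
open import Data.List.Relation.Unary.All using (All; _∷_)
import Data.List.Relation.Unary.AllPairs as AllPairs
open import Data.List.Relation.Unary.AllPairs using (AllPairs; []; _∷_)
open import Data.List.Relation.Unary.Any using (here; there)
open import Data.List.Relation.Unary.Sorted.TotalOrder.Properties using (Sorted⇒AllPairs)
open import Data.List.Relation.Unary.Unique.DecPropositional.Properties using (deduplicate-!)
open import Data.List.Relation.Unary.Unique.Propositional using (Unique)
open import Data.List.Relation.Unary.Unique.Propositional.Properties using (filter⁺; allFin⁺)
import Data.Nat as ℕ
open import Data.Nat using (ℕ; suc; _+_; _*_; _≤_; _<_; _≤?_; z≤n; s≤s)
import Data.Nat.Properties as ℕ
open import Data.Nat.Properties
  using (+-suc; +-comm; +-mono-≤; +-monoˡ-≤; *-zeroʳ; *-comm; *-cancelˡ-≤; *-distribˡ-+; ≤-refl; ≤-trans;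
         ≤-reflexive; n≤1+n; m≤n+m; <-irrefl; ≰⇒>; +-commutativeSemigroup; module ≤-Reasoning)
import Data.Product as Product
open import Data.Product using (∃-syntax; _×_; _,_; proj₁; proj₂)
open import Data.Product.Properties using (≡-dec)
import Data.Sum as Sum
open import Data.Sum using (_⊎_; inj₁; inj₂; swap)
open import Data.Vec using ([]; _∷_; lookup; there)
open import Data.Vec.Functional using (updateAt)
open import Data.Vec.Functional.Properties using (updateAt-updates; updateAt-minimal)
open import Data.Vec.Properties using (lookup⇒[]=; lookup-zipWith)
open import Function using (_∘_; id)
open import Relation.Binary.Bundles using (DecTotalOrder)
import Relation.Binary.Construct.On as On
open import Relation.Binary.Definitions using (DecidableEquality; tri<; tri≈; tri>)
open import Relation.Binary.PropositionalEquality
  using (_≡_; _≢_; refl; cong; cong₂; trans; sym; subst; subst₂; setoid)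
open import Relation.Nullary using (¬_; Dec; yes; no; does; contradiction; ¬?)
open import Relation.Nullary.Decidable using (_×-dec_; decidable-stable; dec-true; map′; T?)

⟦_⟧ : Bool → ℕ
⟦ true ⟧  = 1
⟦ false ⟧ = 0

⟦∧⟧+⟦∨⟧ : ∀ a₁ b₁ a₂ b₂ →
          ⟦ (a₁ ∧ b₁) ∨ (a₂ ∧ b₂) ⟧ + ⟦ (a₁ ∨ b₁) ∨ (a₂ ∨ b₂) ⟧ ≤ ⟦ a₁ ∨ a₂ ⟧ + ⟦ b₁ ∨ b₂ ⟧
⟦∧⟧+⟦∨⟧ true  true  _     _     = ≤-refl
⟦∧⟧+⟦∨⟧ false false true  true  = ≤-refl
⟦∧⟧+⟦∨⟧ false false true  false = ≤-refl
⟦∧⟧+⟦∨⟧ false false false true  = ≤-refl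
⟦∧⟧+⟦∨⟧ false false false false = ≤-refl
⟦∧⟧+⟦∨⟧ true  false true  true  = ≤-refl
⟦∧⟧+⟦∨⟧ true  false false true  = n≤1+n 1
⟦∧⟧+⟦∨⟧ true  false true  false = ≤-refl
⟦∧⟧+⟦∨⟧ true  false false false = ≤-refl
⟦∧⟧+⟦∨⟧ false true  true  true  = ≤-refl
⟦∧⟧+⟦∨⟧ false true  true  false = n≤1+n 1
⟦∧⟧+⟦∨⟧ false true  false true  = ≤-refl
⟦∧⟧+⟦∨⟧ false true  false false = ≤-refl

⟦∨⟧≤⟦⟧+⟦⟧ : ∀ a b → ⟦ a ∨ b ⟧ ≤ ⟦ a ⟧ + ⟦ b ⟧
⟦∨⟧≤⟦⟧+⟦⟧ true  b = s≤s z≤n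
⟦∨⟧≤⟦⟧+⟦⟧ false b = ≤-refl

⟦⟧+⟦⟧≤2*⟦∨⟧ : ∀ a b → ⟦ a ⟧ + ⟦ b ⟧ ≤ 2 * ⟦ a ∨ b ⟧
⟦⟧+⟦⟧≤2*⟦∨⟧ true  true  = ≤-refl
⟦⟧+⟦⟧≤2*⟦∨⟧ true  false = n≤1+n 1
⟦⟧+⟦⟧≤2*⟦∨⟧ false true  = n≤1+n 1
⟦⟧+⟦⟧≤2*⟦∨⟧ false false = ≤-refl

⟦⟧≤1 : ∀ b → ⟦ b ⟧ ≤ 1
⟦⟧≤1 true  = ≤-refl
⟦⟧≤1 false = z≤n

∣p∪q∣+∣p∩q∣≡∣p∣+∣q∣ : ∀ {n} (p q : Subset n) → ∣ p ∪ q ∣ + ∣ p ∩ q ∣ ≡ ∣ p ∣ + ∣ q ∣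
∣p∪q∣+∣p∩q∣≡∣p∣+∣q∣ []            []            = refl
∣p∪q∣+∣p∩q∣≡∣p∣+∣q∣ (outside ∷ p) (outside ∷ q) = ∣p∪q∣+∣p∩q∣≡∣p∣+∣q∣ p q
∣p∪q∣+∣p∩q∣≡∣p∣+∣q∣ (inside  ∷ p) (outside ∷ q) = cong suc (∣p∪q∣+∣p∩q∣≡∣p∣+∣q∣ p q)
∣p∪q∣+∣p∩q∣≡∣p∣+∣q∣ (outside ∷ p) (inside  ∷ q) =
  trans (cong suc (∣p∪q∣+∣p∩q∣≡∣p∣+∣q∣ p q)) (sym (+-suc ∣ p ∣ ∣ q ∣))
∣p∪q∣+∣p∩q∣≡∣p∣+∣q∣ (inside  ∷ p) (inside  ∷ q) =
  cong suc (trans (+-suc ∣ p ∪ q ∣ ∣ p ∩ q ∣)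
                  (trans (cong suc (∣p∪q∣+∣p∩q∣≡∣p∣+∣q∣ p q)) (sym (+-suc ∣ p ∣ ∣ q ∣))))

lookup-∉ : ∀ {n} {S : Subset n} {x} → x ∉ S → lookup S x ≡ outside
lookup-∉ {S = S} {x} x∉S with lookup S x in eq
... | inside  = contradiction (lookup⇒[]= x S eq) x∉S
... | outside = refl

x∉p-x : ∀ {n} (p : Subset n) x → x ∉ p - x
x∉p-x (_ ∷ p) zero    ()
x∉p-x (_ ∷ p) (suc x) (there x∈p-x) = x∉p-x p x x∈p-x

sumOver : ∀ {n} → Subset n → (Fin n → ℕ) → ℕ
sumOver []            h = 0
sumOver (inside  ∷ S) h = h zero + sumOver S (h ∘ suc)
sumOver (outside ∷ S) h = sumOver S (h ∘ suc)

sumOver-+ : ∀ {n} (S : Subset n) g h → sumOver S (λ u → g u + h u) ≡ sumOver S g + sumOver S h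
sumOver-+ []            g h = refl
sumOver-+ (inside  ∷ S) g h = trans (cong (g zero + h zero +_) (sumOver-+ S (g ∘ suc) (h ∘ suc)))
                                    (interchange +-commutativeSemigroup (g zero) (h zero) _ _)
sumOver-+ (outside ∷ S) g h = sumOver-+ S (g ∘ suc) (h ∘ suc)

sumOver-mono-≤ : ∀ {n} (S : Subset n) {g h} → (∀ u → g u ≤ h u) → sumOver S g ≤ sumOver S h
sumOver-mono-≤ []            g≤h = z≤n
sumOver-mono-≤ (inside  ∷ S) g≤h = +-mono-≤ (g≤h zero) (sumOver-mono-≤ S (g≤h ∘ suc))
sumOver-mono-≤ (outside ∷ S) g≤h = sumOver-mono-≤ S (g≤h ∘ suc)

sumOver-const : ∀ {n} (S : Subset n) k → sumOver S (λ _ → k) ≡ ∣ S ∣ * k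
sumOver-const []            k = refl
sumOver-const (inside  ∷ S) k = cong (k +_) (sumOver-const S k)
sumOver-const (outside ∷ S) k = sumOver-const S k

sumOver-indicator : ∀ {n} (S : Subset n) (x : Fin n) → sumOver S (λ u → ⟦ does (u ≟ x) ⟧) ≡ ⟦ lookup S x ⟧
sumOver-indicator (inside  ∷ S) zero    = cong suc (trans (sumOver-const S 0) (*-zeroʳ ∣ S ∣))
sumOver-indicator (outside ∷ S) zero    = trans (sumOver-const S 0) (*-zeroʳ ∣ S ∣)
sumOver-indicator (inside  ∷ S) (suc x) = sumOver-indicator S x
sumOver-indicator (outside ∷ S) (suc x) = sumOver-indicator S x

dist-below : ∀ {a b t : ℤ} → a ℤ.≤ b → b ℤ.≤ t → ℤ.∣ a ℤ.- b ∣ ≤ ℤ.∣ a ℤ.- t ∣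
dist-below {a} {b} {t} a≤b b≤t = ℤ.drop‿+≤+ (begin
  ℤ.+ ℤ.∣ a ℤ.- b ∣  ≡⟨ ℤ.∣-∣-≤ a≤b ⟩
  b ℤ.- a            ≤⟨ ℤ.+-monoˡ-≤ (ℤ.- a) b≤t ⟩
  t ℤ.- a            ≡⟨ ℤ.∣-∣-≤ (ℤ.≤-trans a≤b b≤t) ⟨
  ℤ.+ ℤ.∣ a ℤ.- t ∣  ∎)
  where open ℤ.≤-Reasoning

dist-above : ∀ {a b t : ℤ} → a ℤ.≤ b → t ℤ.≤ a → ℤ.∣ a ℤ.- b ∣ ≤ ℤ.∣ b ℤ.- t ∣
dist-above {a} {b} {t} a≤b t≤a = ℤ.drop‿+≤+ (begin
  ℤ.+ ℤ.∣ a ℤ.- b ∣  ≡⟨ ℤ.∣-∣-≤ a≤b ⟩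
  b ℤ.- a            ≤⟨ ℤ.+-monoʳ-≤ b (ℤ.neg-mono-≤ t≤a) ⟩
  b ℤ.- t            ≡⟨ ℤ.∣-∣-≤ (ℤ.≤-trans t≤a a≤b) ⟨
  ℤ.+ ℤ.∣ t ℤ.- b ∣  ≡⟨ cong ℤ.+_ (ℤ.∣i-j∣≡∣j-i∣ t b) ⟩
  ℤ.+ ℤ.∣ b ℤ.- t ∣  ∎)
  where open ℤ.≤-Reasoning

SameSide : ℤ → ℤ → ℤ → Set
SameSide t a b = (a ℤ.≤ t × b ℤ.≤ t) ⊎ (t ℤ.≤ a × t ℤ.≤ b)

sameSide-dist-ordered : ∀ {a b t k} → a ℤ.≤ b → SameSide t a b →
                        ℤ.∣ a ℤ.- t ∣ ≤ k → ℤ.∣ b ℤ.- t ∣ ≤ k → ℤ.∣ a ℤ.- b ∣ ≤ k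
sameSide-dist-ordered a≤b (inj₁ (_ , b≤t)) a≈t _   = ≤-trans (dist-below a≤b b≤t) a≈t
sameSide-dist-ordered a≤b (inj₂ (t≤a , _)) _   b≈t = ≤-trans (dist-above a≤b t≤a) b≈t

sameSide-dist : ∀ {a b t k} → SameSide t a b → ℤ.∣ a ℤ.- t ∣ ≤ k → ℤ.∣ b ℤ.- t ∣ ≤ k → ℤ.∣ a ℤ.- b ∣ ≤ k
sameSide-dist {a} {b} {k = k} side a≈t b≈t with ℤ.≤-total a b
... | inj₁ a≤b = sameSide-dist-ordered a≤b side a≈t b≈t
... | inj₂ b≤a = subst (_≤ k) (ℤ.∣i-j∣≡∣j-i∣ b a)
                       (sameSide-dist-ordered b≤a (Sum.map Product.swap Product.swap side) b≈t a≈t)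

module Incidence {n : ℕ} {E : Set} (ends : E → Fin n × Fin n) where

  end₁ end₂ : E → Fin n
  end₁ = proj₁ ∘ ends
  end₂ = proj₂ ∘ ends

  Endpoint : Fin n → E → Set
  Endpoint u e = u ≡ end₁ e ⊎ u ≡ end₂ e

  isEndpoint : Fin n → E → Bool
  isEndpoint u e = does (u ≟ end₁ e) ∨ does (u ≟ end₂ e)

  meets : Subset n → E → Bool
  meets S e = lookup S (end₁ e) ∨ lookup S (end₂ e)

  edgesMeeting : Subset n → List E → ℕ
  edgesMeeting S []       = 0
  edgesMeeting S (e ∷ es) = ⟦ meets S e ⟧ + edgesMeeting S es

  degreeIn : List E → Fin n → ℕ
  degreeIn []       u = 0
  degreeIn (e ∷ es) u = ⟦ isEndpoint u e ⟧ + degreeIn es u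

  HallCondition : List E → Subset n → Set
  HallCondition es L = ∀ S → S ⊆ L → ∣ S ∣ ≤ edgesMeeting S es

  HallCondition? : ∀ es L → Dec (HallCondition es L)
  HallCondition? es L with anySubset? (λ S → (S ⊆? L) ×-dec ¬? (∣ S ∣ ≤? edgesMeeting S es))
  ... | yes (S , S⊆L , violated) = no (λ hall → violated (hall S S⊆L))
  ... | no ¬violated = yes (λ S S⊆L → decidable-stable (∣ S ∣ ≤? edgesMeeting S es)
                                                         (λ violated → ¬violated (S , S⊆L , violated)))

  HallCondition-[] : ∀ {L u} → HallCondition [] L → u ∉ L
  HallCondition-[] {L} {u} hall u∈L =
    contradiction (subst (_≤ 0) (∣⁅x⁆∣≡1 u) (hall ⁅ u ⁆ ⁅u⁆⊆L)) λ ()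
    where
    ⁅u⁆⊆L : ⁅ u ⁆ ⊆ L
    ⁅u⁆⊆L v∈⁅u⁆ = subst (_∈ L) (sym (x∈⁅y⁆⇒x≡y u v∈⁅u⁆)) u∈L

  meets-∉ : ∀ {S e} → end₁ e ∉ S → end₂ e ∉ S → meets S e ≡ false
  meets-∉ x∉S y∉S rewrite lookup-∉ x∉S | lookup-∉ y∉S = refl

  HallCondition-∷⁻ : ∀ {e es L L′} → HallCondition (e ∷ es) L → L′ ⊆ L →
                     end₁ e ∉ L′ → end₂ e ∉ L′ → HallCondition es L′
  HallCondition-∷⁻ {e} {es} hall L′⊆L x∉L′ y∉L′ S S⊆L′ =
    subst (λ b → ∣ S ∣ ≤ ⟦ b ⟧ + edgesMeeting S es) (meets-∉ (x∉L′ ∘ S⊆L′) (y∉L′ ∘ S⊆L′))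
          (hall S (⊆-trans S⊆L′ L′⊆L))

  meets-∩+meets-∪ : ∀ A B e → ⟦ meets (A ∩ B) e ⟧ + ⟦ meets (A ∪ B) e ⟧ ≤ ⟦ meets A e ⟧ + ⟦ meets B e ⟧
  meets-∩+meets-∪ A B e =
    subst₂ (λ i u → ⟦ i ⟧ + ⟦ u ⟧ ≤ ⟦ meets A e ⟧ + ⟦ meets B e ⟧)
           (sym (cong₂ _∨_ (lookup-zipWith _∧_ x A B) (lookup-zipWith _∧_ y A B)))
           (sym (cong₂ _∨_ (lookup-zipWith _∨_ x A B) (lookup-zipWith _∨_ y A B)))
           (⟦∧⟧+⟦∨⟧ (lookup A x) (lookup B x) (lookup A y) (lookup B y))
    where x = end₁ e; y = end₂ e

  edgesMeeting-submodular : ∀ A B es →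
    edgesMeeting (A ∩ B) es + edgesMeeting (A ∪ B) es ≤ edgesMeeting A es + edgesMeeting B es
  edgesMeeting-submodular A B []       = z≤n
  edgesMeeting-submodular A B (e ∷ es) = begin
    (⟦ meets (A ∩ B) e ⟧ + edgesMeeting (A ∩ B) es) + (⟦ meets (A ∪ B) e ⟧ + edgesMeeting (A ∪ B) es)
      ≡⟨ interchange +-commutativeSemigroup ⟦ meets (A ∩ B) e ⟧ _ ⟦ meets (A ∪ B) e ⟧ _ ⟩
    (⟦ meets (A ∩ B) e ⟧ + ⟦ meets (A ∪ B) e ⟧) + (edgesMeeting (A ∩ B) es + edgesMeeting (A ∪ B) es)
      ≤⟨ +-mono-≤ (meets-∩+meets-∪ A B e) (edgesMeeting-submodular A B es) ⟩
    (⟦ meets A e ⟧ + ⟦ meets B e ⟧) + (edgesMeeting A es + edgesMeeting B es)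
      ≡⟨ interchange +-commutativeSemigroup ⟦ meets A e ⟧ _ (edgesMeeting A es) _ ⟩
    (⟦ meets A e ⟧ + edgesMeeting A es) + (⟦ meets B e ⟧ + edgesMeeting B es) ∎
    where open ≤-Reasoning

  -- By submodularity, S₁ ∪ S₂ and S₁ ∩ S₂ would together violate Hall's condition for e ∷ es,
  -- the intersection avoiding both endpoints of e.
  no-two-violators : ∀ {e es L S₁ S₂} → HallCondition (e ∷ es) L →
                     S₁ ⊆ L - end₁ e → S₂ ⊆ L - end₂ e →
                     edgesMeeting S₁ es < ∣ S₁ ∣ → edgesMeeting S₂ es < ∣ S₂ ∣ → ⊥
  no-two-violators {e} {es} {L} {S₁} {S₂} hall S₁⊆L-x S₂⊆L-y S₁-violates S₂-violates =
    <-irrefl refl count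
    where
    N : Subset n → ℕ
    N S = edgesMeeting S es

    ∩-bound : ∣ S₁ ∩ S₂ ∣ ≤ N (S₁ ∩ S₂)
    ∩-bound = subst (λ b → ∣ S₁ ∩ S₂ ∣ ≤ ⟦ b ⟧ + N (S₁ ∩ S₂))
                    (meets-∉ (x∉p-x L (end₁ e) ∘ S₁⊆L-x ∘ p∩q⊆p S₁ S₂)
                             (x∉p-x L (end₂ e) ∘ S₂⊆L-y ∘ p∩q⊆q S₁ S₂))
                    (hall (S₁ ∩ S₂) (p─q⊆p L _ ∘ S₁⊆L-x ∘ p∩q⊆p S₁ S₂))

    S₁∪S₂⊆L : S₁ ∪ S₂ ⊆ L
    S₁∪S₂⊆L u∈S₁∪S₂ with x∈p∪q⁻ S₁ S₂ u∈S₁∪S₂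
    ... | inj₁ u∈S₁ = p─q⊆p L _ (S₁⊆L-x u∈S₁)
    ... | inj₂ u∈S₂ = p─q⊆p L _ (S₂⊆L-y u∈S₂)

    ∪-bound : ∣ S₁ ∪ S₂ ∣ ≤ suc (N (S₁ ∪ S₂))
    ∪-bound = ≤-trans (hall (S₁ ∪ S₂) S₁∪S₂⊆L) (+-monoˡ-≤ _ (⟦⟧≤1 (meets (S₁ ∪ S₂) e)))

    count : suc (N S₁ + N S₂) < suc (N S₁ + N S₂)
    count = begin-strict
      suc (N S₁ + N S₂)                ≡⟨ +-suc (N S₁) (N S₂) ⟨
      N S₁ + suc (N S₂)                <⟨ +-mono-≤ S₁-violates S₂-violates ⟩
      ∣ S₁ ∣ + ∣ S₂ ∣                  ≡⟨ ∣p∪q∣+∣p∩q∣≡∣p∣+∣q∣ S₁ S₂ ⟨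
      ∣ S₁ ∪ S₂ ∣ + ∣ S₁ ∩ S₂ ∣        ≤⟨ +-mono-≤ ∪-bound ∩-bound ⟩
      suc (N (S₁ ∪ S₂) + N (S₁ ∩ S₂))  ≡⟨ cong suc (+-comm (N (S₁ ∪ S₂)) _) ⟩
      suc (N (S₁ ∩ S₂) + N (S₁ ∪ S₂))  ≤⟨ s≤s (edgesMeeting-submodular S₁ S₂ es) ⟩
      suc (N S₁ + N S₂)                ∎
      where open ≤-Reasoning

  HallCondition-choice : ∀ {e es L} → HallCondition (e ∷ es) L →
                         ¬ HallCondition es (L - end₁ e) → HallCondition es (L - end₂ e)
  HallCondition-choice {e} {es} {L} hall ¬hall₁ S₂ S₂⊆L-y =
    decidable-stable (∣ S₂ ∣ ≤? edgesMeeting S₂ es) λ S₂-violates →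
      ¬hall₁ λ S₁ S₁⊆L-x → decidable-stable (∣ S₁ ∣ ≤? edgesMeeting S₁ es) λ S₁-violates →
        no-two-violators {e} {es} hall S₁⊆L-x S₂⊆L-y (≰⇒> S₁-violates) (≰⇒> S₂-violates)

  isEndpoint-complete : ∀ {u e} → Endpoint u e → isEndpoint u e ≡ true
  isEndpoint-complete {u} {e} (inj₁ u≡x) rewrite dec-true (u ≟ end₁ e) u≡x = refl
  isEndpoint-complete {u} {e} (inj₂ u≡y) rewrite dec-true (u ≟ end₂ e) u≡y = ∨-zeroʳ _

  1≤degreeIn : ∀ {es e u} → e ∈ₗ es → Endpoint u e → 1 ≤ degreeIn es u
  1≤degreeIn (here refl) u∈e rewrite isEndpoint-complete u∈e = s≤s z≤n
  1≤degreeIn (there e∈es) u∈e = ≤-trans (1≤degreeIn e∈es u∈e) (m≤n+m _ _)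

  2≤degreeIn : ∀ {es e₁ e₂ u} → e₁ ∈ₗ es → e₂ ∈ₗ es → e₁ ≢ e₂ →
               Endpoint u e₁ → Endpoint u e₂ → 2 ≤ degreeIn es u
  2≤degreeIn (here refl)   (here refl)   e₁≢e₂ _ _ = contradiction refl e₁≢e₂
  2≤degreeIn (here refl)   (there e₂∈es) _ u∈e₁ u∈e₂
    rewrite isEndpoint-complete u∈e₁ = s≤s (1≤degreeIn e₂∈es u∈e₂)
  2≤degreeIn (there e₁∈es) (here refl)   _ u∈e₁ u∈e₂
    rewrite isEndpoint-complete u∈e₂ = s≤s (1≤degreeIn e₁∈es u∈e₁)
  2≤degreeIn (there e₁∈es) (there e₂∈es) e₁≢e₂ u∈e₁ u∈e₂ =
    ≤-trans (2≤degreeIn e₁∈es e₂∈es e₁≢e₂ u∈e₁ u∈e₂) (m≤n+m _ _)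

  sumOver-isEndpoint : ∀ S e → sumOver S (λ u → ⟦ isEndpoint u e ⟧) ≤ 2 * ⟦ meets S e ⟧
  sumOver-isEndpoint S e = begin
    sumOver S (λ u → ⟦ isEndpoint u e ⟧)
      ≤⟨ sumOver-mono-≤ S (λ u → ⟦∨⟧≤⟦⟧+⟦⟧ (does (u ≟ x)) _) ⟩
    sumOver S (λ u → ⟦ does (u ≟ x) ⟧ + ⟦ does (u ≟ y) ⟧)
      ≡⟨ sumOver-+ S _ _ ⟩
    sumOver S (λ u → ⟦ does (u ≟ x) ⟧) + sumOver S (λ u → ⟦ does (u ≟ y) ⟧)
      ≡⟨ cong₂ _+_ (sumOver-indicator S x) (sumOver-indicator S y) ⟩
    ⟦ lookup S x ⟧ + ⟦ lookup S y ⟧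
      ≤⟨ ⟦⟧+⟦⟧≤2*⟦∨⟧ (lookup S x) _ ⟩
    2 * ⟦ meets S e ⟧ ∎
    where
    open ≤-Reasoning
    x = end₁ e; y = end₂ e

  sumOver-degreeIn : ∀ S es → sumOver S (degreeIn es) ≤ 2 * edgesMeeting S es
  sumOver-degreeIn S []       = ≤-reflexive (trans (sumOver-const S 0) (*-zeroʳ ∣ S ∣))
  sumOver-degreeIn S (e ∷ es) = begin
    sumOver S (λ u → ⟦ isEndpoint u e ⟧ + degreeIn es u)
      ≡⟨ sumOver-+ S _ _ ⟩
    sumOver S (λ u → ⟦ isEndpoint u e ⟧) + sumOver S (degreeIn es)
      ≤⟨ +-mono-≤ (sumOver-isEndpoint S e) (sumOver-degreeIn S es) ⟩
    2 * ⟦ meets S e ⟧ + 2 * edgesMeeting S es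
      ≡⟨ sym (*-distribˡ-+ 2 ⟦ meets S e ⟧ _) ⟩
    2 * edgesMeeting S (e ∷ es) ∎
    where open ≤-Reasoning

  HallCondition-minDegree : ∀ {es} → (∀ u → 2 ≤ degreeIn es u) → ∀ {L} → HallCondition es L
  HallCondition-minDegree {es} 2≤deg S _ = *-cancelˡ-≤ 2 (begin
    2 * ∣ S ∣                ≡⟨ *-comm 2 ∣ S ∣ ⟩
    ∣ S ∣ * 2                ≡⟨ sumOver-const S 2 ⟨
    sumOver S (λ _ → 2)      ≤⟨ sumOver-mono-≤ S 2≤deg ⟩
    sumOver S (degreeIn es)  ≤⟨ sumOver-degreeIn S es ⟩
    2 * edgesMeeting S es    ∎)
    where open ≤-Reasoning

  Endpoint-∉ : ∀ {u e L} → end₁ e ∉ L → end₂ e ∉ L → Endpoint u e → u ∉ L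
  Endpoint-∉ x∉L _   (inj₁ refl) = x∉L
  Endpoint-∉ _   y∉L (inj₂ refl) = y∉L

  module Labelling (w : E → ℤ) where

    Below Above : (Fin n → ℤ) → Subset n → E → Set
    Below label L e = ∀ {u} → Endpoint u e → u ∈ L → label u ℤ.≤ w e
    Above label L e = ∀ {u} → Endpoint u e → u ∈ L × w e ℤ.≤ label u

    record EdgeLabelling (es : List E) (L : Subset n) : Set where
      field
        label     : Fin n → ℤ
        incident  : ∀ {u} → u ∈ L → ∃[ e ] e ∈ₗ es × Endpoint u e × label u ≡ w e
        injective : ∀ {u v} → u ∈ L → v ∈ L → label u ≡ label v → u ≡ v
        sameSide  : ∀ {e} → e ∈ₗ es → Below label L e ⊎ Above label L e

    empty : ∀ {L} → (∀ {u} → u ∉ L) → EdgeLabelling [] L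
    empty ∉L = record
      { label     = λ _ → 0ℤ
      ; incident  = λ u∈L → contradiction u∈L ∉L
      ; injective = λ u∈L _ _ → contradiction u∈L ∉L
      ; sameSide  = λ ()
      }

    skip : ∀ {e es L} → end₁ e ∉ L → end₂ e ∉ L → EdgeLabelling es L → EdgeLabelling (e ∷ es) L
    skip x∉L y∉L lab = record
      { label     = label
      ; incident  = λ u∈L → let (e′ , e′∈es , rest) = incident u∈L in e′ , there e′∈es , rest
      ; injective = injective
      ; sameSide  = λ { (here refl)   → inj₁ (λ u∈e u∈L → contradiction u∈L (Endpoint-∉ x∉L y∉L u∈e))
                      ; (there e′∈es) → sameSide e′∈es }
      }
      where open EdgeLabelling lab

    extend : ∀ {e es L c} d → All (λ e′ → w e ℤ.< w e′) es → c ∈ L → Endpoint c e →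
             (∀ {u} → Endpoint u e → u ≡ c ⊎ u ≡ d) →
             EdgeLabelling es (L - c) → EdgeLabelling (e ∷ es) L
    extend {e} {es} {L} {c} d e<es c∈L c∈e e⊆cd lab = record
      { label     = label′
      ; incident  = incident′
      ; injective = injective′
      ; sameSide  = λ { (here refl) → sameSide-e ; (there e′∈es) → sameSide-es e′∈es }
      }
      where
      open EdgeLabelling lab

      label′ : Fin n → ℤ
      label′ = updateAt label c (λ _ → w e)

      label′-c : label′ c ≡ w e
      label′-c = updateAt-updates c label

      label′-other : ∀ {u} → u ∈ L - c → label′ u ≡ label u
      label′-other {u} u∈L-c = updateAt-minimal u c label (λ { refl → x∉p-x L c u∈L-c })

      split : ∀ {u} → u ∈ L → u ≡ c ⊎ u ∈ L - c
      split {u} u∈L with u ≟ c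
      ... | yes u≡c = inj₁ u≡c
      ... | no  u≢c = inj₂ (x∈p∧x≢y⇒x∈p-y u∈L u≢c)

      heavier : ∀ {u} → u ∈ L - c → w e ℤ.< label′ u
      heavier u∈L-c with incident u∈L-c
      ... | e′ , e′∈es , _ , label≡w =
        subst (w e ℤ.<_) (sym (trans (label′-other u∈L-c) label≡w)) (All.lookup e<es e′∈es)

      incident′ : ∀ {u} → u ∈ L → ∃[ e′ ] e′ ∈ₗ e ∷ es × Endpoint u e′ × label′ u ≡ w e′
      incident′ u∈L with split u∈L
      ... | inj₁ refl  = e , here refl , c∈e , label′-c
      ... | inj₂ u∈L-c with incident u∈L-c
      ...   | e′ , e′∈es , u∈e′ , label≡w = e′ , there e′∈es , u∈e′ , trans (label′-other u∈L-c) label≡w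

      injective′ : ∀ {u v} → u ∈ L → v ∈ L → label′ u ≡ label′ v → u ≡ v
      injective′ u∈L v∈L eq with split u∈L | split v∈L
      ... | inj₁ refl  | inj₁ refl  = refl
      ... | inj₁ refl  | inj₂ v∈L-c = contradiction (trans (sym label′-c) eq) (ℤ.<⇒≢ (heavier v∈L-c))
      ... | inj₂ u∈L-c | inj₁ refl  = contradiction (trans (sym label′-c) (sym eq)) (ℤ.<⇒≢ (heavier u∈L-c))
      ... | inj₂ u∈L-c | inj₂ v∈L-c =
        injective u∈L-c v∈L-c (trans (sym (label′-other u∈L-c)) (trans eq (label′-other v∈L-c)))

      sameSide-e : Below label′ L e ⊎ Above label′ L e
      sameSide-e with d ∈? L - c
      ... | yes d∈L-c = inj₂ above
        where
        above : Above label′ L e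
        above u∈e with e⊆cd u∈e
        ... | inj₁ refl = c∈L , ℤ.≤-reflexive (sym label′-c)
        ... | inj₂ refl = p─q⊆p L _ d∈L-c , ℤ.<⇒≤ (heavier d∈L-c)
      ... | no d∉L-c = inj₁ below
        where
        below : Below label′ L e
        below u∈e u∈L with split u∈L | e⊆cd u∈e
        ... | inj₁ refl  | _         = ℤ.≤-reflexive label′-c
        ... | inj₂ u∈L-c | inj₁ refl = contradiction u∈L-c (x∉p-x L c)
        ... | inj₂ u∈L-c | inj₂ refl = contradiction u∈L-c d∉L-c

      sameSide-es : ∀ {e′} → e′ ∈ₗ es → Below label′ L e′ ⊎ Above label′ L e′
      sameSide-es {e′} e′∈es with sameSide e′∈es
      ... | inj₁ below = inj₁ below′
        where
        below′ : Below label′ L e′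
        below′ u∈e′ u∈L with split u∈L
        ... | inj₁ refl  = ℤ.≤-trans (ℤ.≤-reflexive label′-c) (ℤ.<⇒≤ (All.lookup e<es e′∈es))
        ... | inj₂ u∈L-c = subst (ℤ._≤ w e′) (sym (label′-other u∈L-c)) (below u∈e′ u∈L-c)
      ... | inj₂ above = inj₂ above′
        where
        above′ : Above label′ L e′
        above′ u∈e′ with above u∈e′
        ... | u∈L-c , w≤label = p─q⊆p L _ u∈L-c , subst (w e′ ℤ.≤_) (sym (label′-other u∈L-c)) w≤label

    edgeLabelling : ∀ {es} → AllPairs (λ e e′ → w e ℤ.< w e′) es →
                    ∀ {L} → HallCondition es L → EdgeLabelling es L
    edgeLabelling []                     hall = empty (HallCondition-[] hall)
    edgeLabelling {e ∷ es} (e<es ∷ sorted) {L} hall with end₁ e ∈? L | end₂ e ∈? L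
    ... | no x∉L  | no y∉L  =
      skip x∉L y∉L (edgeLabelling sorted (HallCondition-∷⁻ {e} {es} hall ⊆-refl x∉L y∉L))
    ... | yes x∈L | no y∉L  = extend (end₂ e) e<es x∈L (inj₁ refl) id
      (edgeLabelling sorted (HallCondition-∷⁻ {e} {es} hall (p─q⊆p L _) (x∉p-x L _) (y∉L ∘ p─q⊆p L _)))
    ... | no x∉L  | yes y∈L = extend (end₁ e) e<es y∈L (inj₂ refl) swap
      (edgeLabelling sorted (HallCondition-∷⁻ {e} {es} hall (p─q⊆p L _) (x∉L ∘ p─q⊆p L _) (x∉p-x L _)))
    ... | yes x∈L | yes y∈L with HallCondition? es (L - end₁ e)
    ...   | yes hall₁ = extend (end₂ e) e<es x∈L (inj₁ refl) id (edgeLabelling sorted hall₁)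
    ...   | no ¬hall₁ = extend (end₁ e) e<es y∈L (inj₂ refl) swap
                          (edgeLabelling sorted (HallCondition-choice {e} {es} hall ¬hall₁))

    sameSide-⊤ : ∀ {es e} (lab : EdgeLabelling es ⊤) → e ∈ₗ es →
                 SameSide (w e) (EdgeLabelling.label lab (end₁ e)) (EdgeLabelling.label lab (end₂ e))
    sameSide-⊤ lab e∈es with EdgeLabelling.sameSide lab e∈es
    ... | inj₁ below = inj₁ (below (inj₁ refl) ∈⊤ , below (inj₂ refl) ∈⊤)
    ... | inj₂ above = inj₂ (proj₂ (above (inj₁ refl)) , proj₂ (above (inj₂ refl)))

two-distinct : ∀ {A : Set} {xs : List A} → Unique xs → 2 ≤ length xs →
               ∃[ a ] ∃[ b ] a ∈ₗ xs × b ∈ₗ xs × a ≢ b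
two-distinct {xs = []}          _                ()
two-distinct {xs = _ ∷ []}      _                (s≤s ())
two-distinct {xs = a ∷ b ∷ _} ((a≢b ∷ _) ∷ _) _ = a , b , here refl , there (here refl) , a≢b

module _ {n : ℕ} (G : Graph n) where

  open Incidence (ends G)

  ends-injective : ∀ {e e′ : Edge G} → ends G e ≡ ends G e′ → e ≡ e′
  ends-injective {p , u<v , uv} {.p , u<v′ , uv′} refl =
    cong₂ (λ lt a → p , lt , a) (ℕ.<-irrelevant u<v u<v′) (T-irrelevant uv uv′)

  _≟ₑ_ : DecidableEquality (Edge G)
  e ≟ₑ e′ = map′ ends-injective (cong (ends G)) (≡-dec _≟_ _≟_ (ends G e) (ends G e′))

  edgesAt : Fin n → Fin n → List (Edge G)
  edgesAt u v with toℕ u ℕ.<? toℕ v | T? (adj G u v)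
  ... | yes u<v | yes uv = ((u , v) , u<v , uv) ∷ []
  ... | _       | _      = []

  ∈-edgesAt : ∀ e → e ∈ₗ edgesAt (end₁ e) (end₂ e)
  ∈-edgesAt ((u , v) , u<v , uv) with toℕ u ℕ.<? toℕ v | T? (adj G u v)
  ... | yes _   | yes _   = here (ends-injective refl)
  ... | no u≮v  | _       = contradiction u<v u≮v
  ... | yes _   | no ¬uv  = contradiction uv ¬uv

  allEdges : List (Edge G)
  allEdges = concatMap (λ u → concatMap (edgesAt u) (allFin n)) (allFin n)

  ∈-allEdges : ∀ e → e ∈ₗ allEdges
  ∈-allEdges e =
    ∈-concatMap⁺ _ (lose (∈-allFin (end₁ e)) (∈-concatMap⁺ _ (lose (∈-allFin (end₂ e)) (∈-edgesAt e))))

  Joins : Edge G → Fin n → Fin n → Set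
  Joins e u v = ends G e ≡ (u , v) ⊎ ends G e ≡ (v , u)

  Joins⇒Endpoint : ∀ {e u v} → Joins e u v → Endpoint u e
  Joins⇒Endpoint (inj₁ e=uv) = inj₁ (cong proj₁ (sym e=uv))
  Joins⇒Endpoint (inj₂ e=vu) = inj₂ (cong proj₂ (sym e=vu))

  adj⇒≢ : ∀ {u v} → T (adj G u v) → u ≢ v
  adj⇒≢ {u} uv refl = subst T (irrefl G u) uv

  edgeBetween : ∀ {u v} → T (adj G u v) → ∃[ e ] Joins e u v
  edgeBetween {u} {v} uv with ℕ.<-cmp (toℕ u) (toℕ v)
  ... | tri< u<v _ _ = ((u , v) , u<v , uv) , inj₁ refl
  ... | tri≈ _ u=v _ = contradiction (toℕ-injective u=v) (adj⇒≢ uv)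
  ... | tri> _ _ v<u = ((v , u) , v<u , subst T (Graph.sym G u v) uv) , inj₂ refl

  Joins-unique : ∀ {e u v v′} → u ≢ v → Joins e u v → Joins e u v′ → v ≡ v′
  Joins-unique _   (inj₁ p) (inj₁ q) = cong proj₂ (trans (sym p) q)
  Joins-unique u≢v (inj₁ p) (inj₂ q) = contradiction (sym (cong proj₂ (trans (sym p) q))) u≢v
  Joins-unique u≢v (inj₂ p) (inj₁ q) = contradiction (sym (cong proj₁ (trans (sym p) q))) u≢v
  Joins-unique _   (inj₂ p) (inj₂ q) = cong proj₁ (trans (sym p) q)

  neighbours : Fin n → List (Fin n)
  neighbours u = filter (λ v → T? (adj G u v)) (allFin n)

  ∈-neighbours⁻ : ∀ {u v} → v ∈ₗ neighbours u → T (adj G u v)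
  ∈-neighbours⁻ {u} v∈N = proj₂ (∈-filter⁻ (λ v → T? (adj G u v)) {xs = allFin n} v∈N)

  twoIncidentEdges : minDegree≥ G 2 → ∀ u → ∃[ e₁ ] ∃[ e₂ ] e₁ ≢ e₂ × Endpoint u e₁ × Endpoint u e₂
  twoIncidentEdges minDeg u
    with v₁ , v₂ , v₁∈N , v₂∈N , v₁≢v₂ ← two-distinct (filter⁺ (λ v → T? (adj G u v)) (allFin⁺ n)) (minDeg u)
    with e₁ , e₁-joins ← edgeBetween (∈-neighbours⁻ v₁∈N)
    with e₂ , e₂-joins ← edgeBetween (∈-neighbours⁻ v₂∈N)
    = e₁ , e₂ , e₁≢e₂ , Joins⇒Endpoint {e₁} e₁-joins , Joins⇒Endpoint {e₂} e₂-joins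
    where
    e₁≢e₂ : e₁ ≢ e₂
    e₁≢e₂ refl = v₁≢v₂ (Joins-unique {e₁} (adj⇒≢ (∈-neighbours⁻ v₁∈N)) e₁-joins e₂-joins)

  module _ (f : Edge G → ℤ) where

    private
      byLabel : DecTotalOrder _ _ _
      byLabel = On.decTotalOrder ℤ.≤-decTotalOrder f

    open import Data.List.Sort byLabel using (sort; sort-↭; sort-↗)
    open import Data.List.Relation.Binary.Permutation.Setoid.Properties (setoid (Edge G)) using (Unique-resp-↭)

    -- allEdges has no repetitions already; deduplicate just makes that evident (Unique).
    sortedEdges : List (Edge G)
    sortedEdges = sort (deduplicate _≟ₑ_ allEdges)

    ∈-sortedEdges : ∀ e → e ∈ₗ sortedEdges
    ∈-sortedEdges e = ∈-resp-↭ (↭-sym (sort-↭ _)) (∈-deduplicate⁺ _≟ₑ_ (∈-allEdges e))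

    sortedEdges-increasing : (∀ e e′ → f e ≡ f e′ → ends G e ≡ ends G e′) →
                             AllPairs (λ e e′ → f e ℤ.< f e′) sortedEdges
    sortedEdges-increasing f-inj = AllPairs.zipWith
      (λ (fe≤fe′ , e≢e′) → ℤ.≤∧≢⇒< fe≤fe′ (e≢e′ ∘ ends-injective ∘ f-inj _ _))
      ( Sorted⇒AllPairs (DecTotalOrder.totalOrder byLabel) (sort-↗ _)
      , Unique-resp-↭ (↭⇒↭ₛ (↭-sym (sort-↭ _))) (deduplicate-! _≟ₑ_ allEdges))

    minDegree⇒degreeIn : minDegree≥ G 2 → ∀ u → 2 ≤ degreeIn sortedEdges u
    minDegree⇒degreeIn minDeg u with e₁ , e₂ , e₁≢e₂ , u∈e₁ , u∈e₂ ← twoIncidentEdges minDeg u =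
      2≤degreeIn (∈-sortedEdges e₁) (∈-sortedEdges e₂) e₁≢e₂ u∈e₁ u∈e₂

  shareEnd : ∀ {u} (e e′ : Edge G) → Endpoint u e → Endpoint u e′ → ShareEnd G e e′
  shareEnd _ _ (inj₁ refl) (inj₁ refl) = inj₁ refl
  shareEnd _ _ (inj₁ refl) (inj₂ refl) = inj₂ (inj₁ refl)
  shareEnd _ _ (inj₂ refl) (inj₁ refl) = inj₂ (inj₂ (inj₁ refl))
  shareEnd _ _ (inj₂ refl) (inj₂ refl) = inj₂ (inj₂ (inj₂ refl))

  EBW≤-incident : ∀ (F : EdgeNumbering G) {k} → EBW≤ G F k →
                  ∀ {u e e′} → Endpoint u e → Endpoint u e′ → ℤ.∣ proj₁ F e ℤ.- proj₁ F e′ ∣ ≤ k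
  EBW≤-incident (f , _) {k} bw {e = e} {e′} u∈e u∈e′ with e ≟ₑ e′
  ... | yes refl = subst (λ i → ℤ.∣ i ∣ ≤ k) (sym (ℤ.+-inverseʳ (f e))) z≤n
  ... | no  e≢e′ = bw e e′ (e≢e′ ∘ ends-injective) (shareEnd e e′ u∈e u∈e′)

  module _ (F : EdgeNumbering G) {k} (bw : EBW≤ G F k) where

    open Labelling (proj₁ F)

    label-near : ∀ {es L} (lab : EdgeLabelling es L) → ∀ {u e} → u ∈ L → Endpoint u e →
                 ℤ.∣ EdgeLabelling.label lab u ℤ.- proj₁ F e ∣ ≤ k
    label-near lab u∈L u∈e with e′ , _ , u∈e′ , label≡f ← EdgeLabelling.incident lab u∈L =
      subst (λ i → ℤ.∣ i ℤ.- _ ∣ ≤ k) (sym label≡f) (EBW≤-incident F bw u∈e′ u∈e)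

    labelling-bandwidth : ∀ {es} → (∀ e → e ∈ₗ es) → (lab : EdgeLabelling es ⊤) →
                          VBW≤ G (EdgeLabelling.label lab , λ _ _ → EdgeLabelling.injective lab ∈⊤ ∈⊤) k
    labelling-bandwidth complete lab e =
      sameSide-dist (sameSide-⊤ lab (complete e))
                    (label-near lab ∈⊤ (inj₁ refl)) (label-near lab ∈⊤ (inj₂ refl))

lemma5 : ∀ (n : ℕ) (G : Graph n) → minDegree≥ G 2 →
         ∀ (b b' : ℕ) → IsBandwidth G b → IsEdgeBandwidth G b' → b ≤ b'
lemma5 n G minDeg b b′ (_ , b-minimal) ((F@(f , f-inj) , bw) , _) =
  b-minimal (label , λ _ _ → injective ∈⊤ ∈⊤) b′ (labelling-bandwidth G F bw (∈-sortedEdges G f) lab)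
  where
  open Incidence (ends G)
  open Labelling f

  hall : HallCondition (sortedEdges G f) ⊤
  hall = HallCondition-minDegree {sortedEdges G f} (minDegree⇒degreeIn G f minDeg)

  lab : EdgeLabelling (sortedEdges G f) ⊤
  lab = edgeLabelling (sortedEdges-increasing G f f-inj) hall

  open EdgeLabelling lab
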